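{- The language $L=[\lambda]_S=\{x\in\Sigma^*: |x|_a+|x|_b=|x|_{\overline{a}}+|x|_{\overline{b}}\}$ is an almost-confluent congruential language.
   Context: $\Sigma=\{a,b,\overline{a},\overline{b}\}$, $\lambda$ the empty string, $|x|_e$ the number of occurrences of letter $e$ in $x$. $S$ is the Thue system with rules $(a\overline{a},\lambda),(\overline{a}a,\lambda),(a\overline{b},\lambda),(\overline{b}a,\lambda),(b\overline{a},\lambda),(\overline{a}b,\lambda),(b\overline{b},\lambda),(\overline{b}b,\lambda),(a,b),(b,a),(\overline{a},\overline{b}),(\overline{b},\overline{a})$, and $[x]_S$ is the congruence class of $x$ under the congruence $\overset{*}{\leftrightarrow}_S$ generated by $S$. For a Thue system $T$: $x\to_T y$ means one rule application with $|x|>|y|$, $x\Leftrightarrow_T y$ one rule application with $|x|=|y|$; $T$ is almost confluent if whenever $x\overset{*}{\leftrightarrow}_T y$ there are $z_1,z_2$ with $x\overset{*}{\to}_T z_1$, $y\overset{*}{\to}_T z_2$, $z_1\overset{*}{\Leftrightarrow}_T z_2$. A language is an almost-confluent congruential language if it is a union of finitely many congruence classes of $\overset{*}{\leftrightarrow}_T$ for some finite almost confluent Thue system $T$. -}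

module Defs where

open import Data.Nat using (ℕ; zero; suc; _+_; _<_)
open import Data.Bool using (Bool; true; false)
open import Data.List using (List; []; _∷_; _++_; length)
open import Data.List.Membership.Propositional using (_∈_)
open import Data.List.Relation.Unary.Any using (Any)
open import Data.Product using (Σ; ∃; ∃-syntax; _×_; _,_)
open import Data.Sum using (_⊎_)
open import Relation.Binary.PropositionalEquality using (_≡_)
open import Relation.Binary.Construct.Closure.ReflexiveTransitive using (Star)
open import Function.Bundles using (_⇔_)

data Letter : Set where
  a b a̅ b̅ : Letter

Word : Set
Word = List Letter

ε : Word
ε = []

_==_ : Letter → Letter → Bool
a == a = true
b == b = true
a̅ == a̅ = true
b̅ == b̅ = true
_ == _ = false

count : Letter → Word → ℕ
count e [] = 0
count e (c ∷ x) with e == c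
... | true  = suc (count e x)
... | false = count e x

ThueSystem : Set
ThueSystem = List (Word × Word)

data Step (T : ThueSystem) : Word → Word → Set where
  fwd : ∀ u v l r → (l , r) ∈ T → Step T (u ++ l ++ v) (u ++ r ++ v)
  bwd : ∀ u v l r → (l , r) ∈ T → Step T (u ++ r ++ v) (u ++ l ++ v)

_⊢_↔*_ : ThueSystem → Word → Word → Set
T ⊢ x ↔* y = Star (Step T) x y

Reduce : ThueSystem → Word → Word → Set
Reduce T x y = Step T x y × length y < length x

Equal : ThueSystem → Word → Word → Set
Equal T x y = Step T x y × length x ≡ length y

AlmostConfluent : ThueSystem → Set
AlmostConfluent T = ∀ x y → T ⊢ x ↔* y →
  ∃[ z₁ ] ∃[ z₂ ] (Star (Reduce T) x z₁ × Star (Reduce T) y z₂ × Star (Equal T) z₁ z₂)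

Language : Set₁
Language = Word → Set

UnionOfFinitelyManyClasses : ThueSystem → Language → Set
UnionOfFinitelyManyClasses T L =
  Σ (List Word) λ reps → ∀ x → L x ⇔ Any (λ w → T ⊢ x ↔* w) reps

AlmostConfluentCongruential : Language → Set
AlmostConfluentCongruential L =
  Σ ThueSystem λ T → AlmostConfluent T × UnionOfFinitelyManyClasses T L

S : ThueSystem
S = (a ∷ a̅ ∷ [] , ε) ∷ (a̅ ∷ a ∷ [] , ε) ∷ (a ∷ b̅ ∷ [] , ε) ∷ (b̅ ∷ a ∷ [] , ε)
  ∷ (b ∷ a̅ ∷ [] , ε) ∷ (a̅ ∷ b ∷ [] , ε) ∷ (b ∷ b̅ ∷ [] , ε) ∷ (b̅ ∷ b ∷ [] , ε)
  ∷ (a ∷ [] , b ∷ []) ∷ (b ∷ [] , a ∷ []) ∷ (a̅ ∷ [] , b̅ ∷ []) ∷ (b̅ ∷ [] , a̅ ∷ []) ∷ []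

L : Language
L x = count a x + count b x ≡ count a̅ x + count b̅ x

-- Each rule of S preserves the balance #positive − #negative letters, so L is contained in the class
-- of ε. Conversely, cancelling adjacent letters of opposite sign reduces any word by length-decreasing
-- steps to a word whose letters all have the same sign, and the length-preserving rules b → a,
-- b̅ → a̅ turn such a word into aⁿ or a̅ⁿ, a normal form determined by the balance alone. Two congruent
-- words thus reduce to words joined by length-preserving steps, which is almost confluence, and
-- the class of ε is exactly L.
module Submission where

open import Defs
open import Data.Bool using (Bool; true; false)
open import Data.Bool.Properties using () renaming (_≟_ to _≟ᵇ_)
open import Data.Integer using (ℤ; +_; -[1+_]; 0ℤ; 1ℤ; -1ℤ; _+_; _-_; -_)
open import Data.Integer.Properties using (+-identityˡ; +-assoc; +-injective; i-j≡0⇒i≡j; i≡j⇒i-j≡0)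
open import Data.Integer.Tactic.RingSolver using (solve-∀)
open import Data.List using ([]; _∷_; _++_; length; replicate)
open import Data.List.Membership.Propositional using (_∈_)
open import Data.List.Relation.Unary.All as All using (All; []; _∷_)
open import Data.List.Relation.Unary.Any using (here; there)
open import Data.Nat using (ℕ; zero; suc; s≤s)
open import Data.Nat.Properties using (+-suc; <-trans; n<1+n)
open import Data.Product using (_×_; _,_; proj₁; ∃-syntax)
open import Function using (id; _∘_)
open import Function.Bundles using (_⇔_; mk⇔; Equivalence)
open import Relation.Binary.Construct.Closure.ReflexiveTransitive
  using (Star; _◅_; _◅◅_; gmap; reverse) renaming (ε to ◅-nil)
open import Relation.Binary.PropositionalEquality
open import Relation.Nullary using (yes; no; contradiction)

module _ {T : ThueSystem} where

  Step-sym : ∀ {x y} → Step T x y → Step T y x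
  Step-sym (fwd u v l r m) = bwd u v l r m
  Step-sym (bwd u v l r m) = fwd u v l r m

  Equal-sym : ∀ {x y} → Equal T x y → Equal T y x
  Equal-sym (s , eq) = Step-sym s , sym eq

  Step-cons : ∀ c {x y} → Step T x y → Step T (c ∷ x) (c ∷ y)
  Step-cons c (fwd u v l r m) = fwd (c ∷ u) v l r m
  Step-cons c (bwd u v l r m) = bwd (c ∷ u) v l r m

  Reduce*-cons : ∀ c {x y} → Star (Reduce T) x y → Star (Reduce T) (c ∷ x) (c ∷ y)
  Reduce*-cons c = gmap (c ∷_) λ (s , shorter) → Step-cons c s , s≤s shorter

  Equal*-cons : ∀ c {x y} → Star (Equal T) x y → Star (Equal T) (c ∷ x) (c ∷ y)
  Equal*-cons c = gmap (c ∷_) λ (s , eq) → Step-cons c s , cong suc eq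

  Reduce*⇒↔* : ∀ {x y} → Star (Reduce T) x y → T ⊢ x ↔* y
  Reduce*⇒↔* = gmap id proj₁

  Equal*⇒↔* : ∀ {x y} → Star (Equal T) x y → T ⊢ x ↔* y
  Equal*⇒↔* = gmap id proj₁

weight : Letter → ℤ
weight a = 1ℤ
weight b = 1ℤ
weight a̅ = -1ℤ
weight b̅ = -1ℤ

balance : Word → ℤ
balance [] = 0ℤ
balance (c ∷ x) = weight c + balance x

balance-++ : ∀ u v → balance (u ++ v) ≡ balance u + balance v
balance-++ [] v = sym (+-identityˡ (balance v))
balance-++ (c ∷ u) v =
  trans (cong (_+_ (weight c)) (balance-++ u v)) (sym (+-assoc (weight c) (balance u) (balance v)))

module _ {T : ThueSystem} (rules-balanced : ∀ {l r} → (l , r) ∈ T → balance l ≡ balance r) where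

  balance-Step : ∀ {x y} → Step T x y → balance x ≡ balance y
  balance-Step (fwd u v l r m) = begin
    balance (u ++ l ++ v)               ≡⟨ balance-++ u (l ++ v) ⟩
    balance u + balance (l ++ v)        ≡⟨ cong (_+_ (balance u)) (balance-++ l v) ⟩
    balance u + (balance l + balance v) ≡⟨ cong (λ t → balance u + (t + balance v)) (rules-balanced m) ⟩
    balance u + (balance r + balance v) ≡⟨ cong (_+_ (balance u)) (balance-++ r v) ⟨
    balance u + balance (r ++ v)        ≡⟨ balance-++ u (r ++ v) ⟨
    balance (u ++ r ++ v)               ∎
    where open ≡-Reasoning
  balance-Step (bwd u v l r m) = sym (balance-Step (fwd u v l r m))

  balance-↔* : ∀ {x y} → T ⊢ x ↔* y → balance x ≡ balance y
  balance-↔* ◅-nil = refl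
  balance-↔* (s ◅ ss) = trans (balance-Step s) (balance-↔* ss)

S-balanced : ∀ {l r} → (l , r) ∈ S → balance l ≡ balance r
S-balanced = All.lookup every-rule-balanced
  where
  every-rule-balanced : All (λ (l , r) → balance l ≡ balance r) S
  every-rule-balanced = refl ∷ refl ∷ refl ∷ refl ∷ refl ∷ refl ∷ refl ∷ refl ∷ refl ∷ refl ∷ refl ∷ refl ∷ []

#positive #negative : Word → ℕ
#positive x = count a x Data.Nat.+ count b x
#negative x = count a̅ x Data.Nat.+ count b̅ x

private
  1+[p-n]≡[1+p]-n : ∀ p n → 1ℤ + (p - n) ≡ (1ℤ + p) - n
  1+[p-n]≡[1+p]-n = solve-∀

  -1+[p-n]≡p-[1+n] : ∀ p n → -1ℤ + (p - n) ≡ p - (1ℤ + n)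
  -1+[p-n]≡p-[1+n] = solve-∀

balance≡#positive-#negative : ∀ x → balance x ≡ + #positive x - + #negative x
balance≡#positive-#negative [] = refl
balance≡#positive-#negative (a ∷ x) =
  trans (cong (_+_ 1ℤ) (balance≡#positive-#negative x)) (1+[p-n]≡[1+p]-n (+ #positive x) (+ #negative x))
balance≡#positive-#negative (b ∷ x) = begin
  1ℤ + balance x                                  ≡⟨ cong (_+_ 1ℤ) (balance≡#positive-#negative x) ⟩
  1ℤ + (+ #positive x - + #negative x)            ≡⟨ 1+[p-n]≡[1+p]-n (+ #positive x) (+ #negative x) ⟩
  + suc (#positive x) - + #negative x             ≡⟨ cong (λ n → + n - + #negative x) (+-suc (count a x) (count b x)) ⟨
  + #positive (b ∷ x) - + #negative (b ∷ x)       ∎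
  where open ≡-Reasoning
balance≡#positive-#negative (a̅ ∷ x) =
  trans (cong (_+_ -1ℤ) (balance≡#positive-#negative x)) (-1+[p-n]≡p-[1+n] (+ #positive x) (+ #negative x))
balance≡#positive-#negative (b̅ ∷ x) = begin
  -1ℤ + balance x                                 ≡⟨ cong (_+_ -1ℤ) (balance≡#positive-#negative x) ⟩
  -1ℤ + (+ #positive x - + #negative x)           ≡⟨ -1+[p-n]≡p-[1+n] (+ #positive x) (+ #negative x) ⟩
  + #positive x - + suc (#negative x)             ≡⟨ cong (λ n → + #positive x - + n) (+-suc (count a̅ x) (count b̅ x)) ⟨
  + #positive (b̅ ∷ x) - + #negative (b̅ ∷ x)       ∎
  where open ≡-Reasoning

L⇔balance≡0 : ∀ x → L x ⇔ (balance x ≡ 0ℤ)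
L⇔balance≡0 x = mk⇔
  (λ eq → trans (balance≡#positive-#negative x) (i≡j⇒i-j≡0 (cong +_ eq)))
  (λ eq → +-injective (i-j≡0⇒i≡j _ _ (trans (sym (balance≡#positive-#negative x)) eq)))

isPositive : Letter → Bool
isPositive a = true
isPositive b = true
isPositive a̅ = false
isPositive b̅ = false

Uniform : Bool → Word → Set
Uniform s = All (λ c → isPositive c ≡ s)

Homogeneous : Word → Set
Homogeneous z = ∃[ s ] Uniform s z

cancel-∈ : ∀ c d → isPositive c ≢ isPositive d → (c ∷ d ∷ [] , ε) ∈ S
cancel-∈ a a̅ _ = here refl
cancel-∈ a̅ a _ = there (here refl)
cancel-∈ a b̅ _ = there (there (here refl))
cancel-∈ b̅ a _ = there (there (there (here refl)))
cancel-∈ b a̅ _ = there (there (there (there (here refl))))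
cancel-∈ a̅ b _ = there (there (there (there (there (here refl)))))
cancel-∈ b b̅ _ = there (there (there (there (there (there (here refl))))))
cancel-∈ b̅ b _ = there (there (there (there (there (there (there (here refl)))))))
cancel-∈ a a ≢ = contradiction refl ≢
cancel-∈ a b ≢ = contradiction refl ≢
cancel-∈ b a ≢ = contradiction refl ≢
cancel-∈ b b ≢ = contradiction refl ≢
cancel-∈ a̅ a̅ ≢ = contradiction refl ≢
cancel-∈ a̅ b̅ ≢ = contradiction refl ≢
cancel-∈ b̅ a̅ ≢ = contradiction refl ≢
cancel-∈ b̅ b̅ ≢ = contradiction refl ≢

b↦a∈S : (b ∷ [] , a ∷ []) ∈ S
b↦a∈S = there (there (there (there (there (there (there (there (there (here refl)))))))))

b̅↦a̅∈S : (b̅ ∷ [] , a̅ ∷ []) ∈ S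
b̅↦a̅∈S = there (there (there (there (there (there (there (there (there (there (there (here refl)))))))))))

cons-reduces-to-homogeneous : ∀ c z → Homogeneous z → ∃[ z′ ] Star (Reduce S) (c ∷ z) z′ × Homogeneous z′
cons-reduces-to-homogeneous c [] _ = c ∷ [] , ◅-nil , isPositive c , refl ∷ []
cons-reduces-to-homogeneous c (d ∷ z) (s , d≡s ∷ z≡s) with isPositive c ≟ᵇ s
... | yes c≡s = c ∷ d ∷ z , ◅-nil , s , c≡s ∷ d≡s ∷ z≡s
... | no c≢s = z , cancel ◅ ◅-nil , s , z≡s
  where
  cancel : Reduce S (c ∷ d ∷ z) z
  cancel = fwd [] z (c ∷ d ∷ []) ε (cancel-∈ c d (λ c≡d → c≢s (trans c≡d d≡s)))
         , <-trans (n<1+n _) (n<1+n _)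

reduces-to-homogeneous : ∀ x → ∃[ z ] Star (Reduce S) x z × Homogeneous z
reduces-to-homogeneous [] = [] , ◅-nil , true , []
reduces-to-homogeneous (c ∷ x) with reduces-to-homogeneous x
... | z , x→z , hz with cons-reduces-to-homogeneous c z hz
... | z′ , cz→z′ , hz′ = z′ , Reduce*-cons c x→z ◅◅ cz→z′ , hz′

representative : Bool → Letter
representative true = a
representative false = a̅

uniform-⇔*-replicate : ∀ {s} z → Uniform s z → Star (Equal S) z (replicate (length z) (representative s))
uniform-⇔*-replicate [] [] = ◅-nil
uniform-⇔*-replicate (a ∷ z) (refl ∷ z≡s) = Equal*-cons a (uniform-⇔*-replicate z z≡s)
uniform-⇔*-replicate (a̅ ∷ z) (refl ∷ z≡s) = Equal*-cons a̅ (uniform-⇔*-replicate z z≡s)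
uniform-⇔*-replicate (b ∷ z) (refl ∷ z≡s) =
  (fwd [] z (b ∷ []) (a ∷ []) b↦a∈S , refl) ◅ Equal*-cons a (uniform-⇔*-replicate z z≡s)
uniform-⇔*-replicate (b̅ ∷ z) (refl ∷ z≡s) =
  (fwd [] z (b̅ ∷ []) (a̅ ∷ []) b̅↦a̅∈S , refl) ◅ Equal*-cons a̅ (uniform-⇔*-replicate z z≡s)

signed : Bool → ℕ → ℤ
signed true n = + n
signed false n = - + n

-1+signed-false : ∀ n → -1ℤ + signed false n ≡ signed false (suc n)
-1+signed-false zero = refl
-1+signed-false (suc n) = refl

balance-uniform : ∀ {s} z → Uniform s z → balance z ≡ signed s (length z)
balance-uniform {true} [] [] = refl
balance-uniform {false} [] [] = refl
balance-uniform (a ∷ z) (refl ∷ z≡s) = cong (_+_ 1ℤ) (balance-uniform z z≡s)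
balance-uniform (b ∷ z) (refl ∷ z≡s) = cong (_+_ 1ℤ) (balance-uniform z z≡s)
balance-uniform (a̅ ∷ z) (refl ∷ z≡s) = trans (cong (_+_ -1ℤ) (balance-uniform z z≡s)) (-1+signed-false (length z))
balance-uniform (b̅ ∷ z) (refl ∷ z≡s) = trans (cong (_+_ -1ℤ) (balance-uniform z z≡s)) (-1+signed-false (length z))

normalForm : ℤ → Word
normalForm (+ n) = replicate n a
normalForm -[1+ n ] = replicate (suc n) a̅

normalForm-signed : ∀ s n → normalForm (signed s n) ≡ replicate n (representative s)
normalForm-signed true n = refl
normalForm-signed false zero = refl
normalForm-signed false (suc n) = refl

homogeneous-⇔*-normalForm : ∀ z → Homogeneous z → Star (Equal S) z (normalForm (balance z))
homogeneous-⇔*-normalForm z (s , z≡s) = subst (Star (Equal S) z) (sym nf≡) (uniform-⇔*-replicate z z≡s)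
  where
  nf≡ : normalForm (balance z) ≡ replicate (length z) (representative s)
  nf≡ = trans (cong normalForm (balance-uniform z z≡s)) (normalForm-signed s (length z))

reduces-to-normalForm : ∀ x → ∃[ z ] Star (Reduce S) x z × Star (Equal S) z (normalForm (balance x))
reduces-to-normalForm x with reduces-to-homogeneous x
... | z , x→z , hz =
  z , x→z , subst (Star (Equal S) z ∘ normalForm) (sym bx≡bz) (homogeneous-⇔*-normalForm z hz)
  where
  bx≡bz : balance x ≡ balance z
  bx≡bz = balance-↔* S-balanced (Reduce*⇒↔* x→z)

S-almostConfluent : AlmostConfluent S
S-almostConfluent x y x↔*y with reduces-to-normalForm x | reduces-to-normalForm y
... | z₁ , x→z₁ , z₁⇔nf | z₂ , y→z₂ , z₂⇔nf =
  z₁ , z₂ , x→z₁ , y→z₂ , subst (Star (Equal S) z₁ ∘ normalForm) bx≡by z₁⇔nf ◅◅ reverse Equal-sym z₂⇔nf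
  where
  bx≡by : balance x ≡ balance y
  bx≡by = balance-↔* S-balanced x↔*y

↔*ε⇔L : ∀ x → (S ⊢ x ↔* ε) ⇔ L x
↔*ε⇔L x = mk⇔
  (λ x↔*ε → Equivalence.from (L⇔balance≡0 x) (balance-↔* S-balanced x↔*ε))
  (λ Lx → reach-ε (Equivalence.to (L⇔balance≡0 x) Lx))
  where
  reach-ε : balance x ≡ 0ℤ → S ⊢ x ↔* ε
  reach-ε bx≡0 with reduces-to-normalForm x
  ... | z , x→z , z⇔nf = Reduce*⇒↔* x→z ◅◅ Equal*⇒↔* (subst (Star (Equal S) z ∘ normalForm) bx≡0 z⇔nf)

mainTheorem4 : ((x : Word) → (S ⊢ x ↔* ε) ⇔ L x) × AlmostConfluentCongruential L
mainTheorem4 = ↔*ε⇔L , S , S-almostConfluent , ε ∷ [] , λ x → mk⇔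
  (λ Lx → here (Equivalence.from (↔*ε⇔L x) Lx))
  (λ { (here x↔*ε) → Equivalence.to (↔*ε⇔L x) x↔*ε ; (there ()) })
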